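{- Let $f:\{0,1\}^n\to\{0,1\}^n$ be an and-or-network with interaction graph $G$. If $G$ has no two independent cycles, then $f$ has at most $\nu+1$ fixed points, where $\nu$ is the maximum number of vertex-disjoint cycles of $G$.
   Context: The interaction graph of $f$ has vertex set $[n]$ and arc $uv$ (loops allowed) iff $f_v$ depends on $x_u$; $N^-_G(v)$ is the set of in-neighbours of $v$. $f$ is an and-or-network if for every $v$ either $f_v(x)=\bigwedge_{u\in N^-_G(v)}x_u$ for all $x$, or $f_v(x)=\bigvee_{u\in N^-_G(v)}x_u$ for all $x$ (empty conjunction $=1$, empty disjunction $=0$). Cycles are directed without repeated vertices. Two vertex-disjoint cycles are independent if $G$ has no arc from one to the other in either direction. -}

module Defs where

open import Data.Nat using (ℕ; suc; _≤_)
open import Data.Bool using (Bool; true; false; not)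
open import Data.Fin using (Fin; _≟_)
open import Data.List using (List; []; _∷_; _++_; [_]; length)
open import Data.List.Membership.Propositional using (_∈_; _∉_)
open import Data.List.Relation.Unary.All using (All)
open import Data.List.Relation.Unary.AllPairs using (AllPairs)
open import Data.List.Relation.Unary.Linked using (Linked)
open import Data.List.Relation.Unary.Unique.Propositional using (Unique)
open import Data.Product using (Σ; ∃; _×_)
open import Function.Bundles using (_⇔_)
open import Relation.Binary.PropositionalEquality using (_≡_; _≢_; _≗_)
open import Relation.Nullary using (¬_; yes; no)

State : ℕ → Set
State n = Fin n → Bool

BN : ℕ → Set
BN n = State n → State n

flipAt : ∀ {n} → State n → Fin n → State n
flipAt x u w with w ≟ u
... | yes _ = not (x w)
... | no  _ = x w

Arc : ∀ {n} → BN n → Fin n → Fin n → Set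
Arc f u v = ∃ λ x → f x v ≢ f (flipAt x u) v

-- f_v is the conjunction of its in-neighbours (empty conjunction = true)
IsAndAt : ∀ {n} → BN n → Fin n → Set
IsAndAt f v = ∀ x → (f x v ≡ true) ⇔ (∀ u → Arc f u v → x u ≡ true)

-- f_v is the disjunction of its in-neighbours (empty disjunction = false)
IsOrAt : ∀ {n} → BN n → Fin n → Set
IsOrAt f v = ∀ x → (f x v ≡ true) ⇔ (∃ λ u → Arc f u v × x u ≡ true)

data AndOrAt {n} (f : BN n) (v : Fin n) : Set where
  isAnd : IsAndAt f v → AndOrAt f v
  isOr  : IsOrAt f v → AndOrAt f v

AndOrNetwork : ∀ {n} → BN n → Set
AndOrNetwork f = ∀ v → AndOrAt f v

-- A cycle: a nonempty list v₀ … v_{k-1} of distinct vertices with arcs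
-- v₀→v₁→…→v_{k-1}→v₀ (a single vertex with a loop is a cycle of length 1)
data IsCycle {n} (f : BN n) : List (Fin n) → Set where
  cycle : ∀ v vs → Unique (v ∷ vs) → Linked (Arc f) ((v ∷ vs) ++ [ v ]) →
          IsCycle f (v ∷ vs)

Disjoint : ∀ {n} → List (Fin n) → List (Fin n) → Set
Disjoint C D = ∀ w → w ∈ C → w ∉ D

Independent : ∀ {n} → BN n → List (Fin n) → List (Fin n) → Set
Independent f C D =
  Disjoint C D ×
  (∀ u w → u ∈ C → w ∈ D → ¬ Arc f u w) ×
  (∀ u w → u ∈ D → w ∈ C → ¬ Arc f u w)

NoTwoIndependentCycles : ∀ {n} → BN n → Set
NoTwoIndependentCycles f =
  ∀ C D → IsCycle f C → IsCycle f D → ¬ Independent f C D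

DisjointCycles : ∀ {n} → BN n → List (List (Fin n)) → Set
DisjointCycles f Cs = All (IsCycle f) Cs × AllPairs Disjoint Cs

IsMaxDisjointCycles : ∀ {n} → BN n → ℕ → Set
IsMaxDisjointCycles f ν =
  (∃ λ Cs → DisjointCycles f Cs × length Cs ≡ ν) ×
  (∀ Cs → DisjointCycles f Cs → length Cs ≤ ν)

FixedPoint : ∀ {n} → BN n → State n → Set
FixedPoint f x = f x ≗ x

DistinctFixedPoints : ∀ {n} → BN n → List (State n) → Set
DistinctFixedPoints f xs = All (FixedPoint f) xs × AllPairs (λ x y → ¬ (x ≗ y)) xs

-- Two distinct fixed points x, y of an and-or-network are either comparable, or each of the
-- sets {x = 1, y = 0} and {y = 1, x = 0} contains a cycle: every vertex of such a set has an
-- in-neighbour in it (an and-vertex switched on in x has all in-neighbours on in x, an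
-- or-vertex switched off in y has all in-neighbours off in y).  No arc joins the two sets, so
-- these cycles are independent.  Hence without independent cycles the fixed points form a
-- chain x₀ < x₁ < … < x_k, and the sets {x_{i+1} = 1, x_i = 0} are pairwise disjoint and
-- each contains a cycle, so k ≤ ν.
module Submission where

open import Defs
open import Data.Bool using (true; false)
import Data.Bool as Bool
open import Data.Bool.Properties using (¬-not; ⇔→≡)
open import Data.Fin as Fin using (Fin; _≟_)
open import Data.Fin.Properties using (any?; injective⇒≤)
open import Data.List using (List; []; _∷_; _++_; [_]; length; lookup; allFin)
open import Data.List.Membership.Propositional using (_∈_; _∉_)
open import Data.List.Membership.Propositional.Properties using (∈-lookup; ∈-allFin)
open import Data.List.Relation.Binary.Permutation.Propositional
  using (_↭_; ↭-refl; ↭-sym; ↭-trans; ↭-prep; ↭-swap)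
open import Data.List.Relation.Binary.Permutation.Propositional.Properties
  using (All-resp-↭; ↭-length)
open import Data.List.Relation.Binary.Sublist.Propositional using (_⊆_; _⊇_; []; _∷_; _∷ʳ_; minimum)
open import Data.List.Relation.Binary.Sublist.Propositional.Properties using (All-resp-⊆)
open import Data.List.Relation.Unary.All as All using (All; []; _∷_)
open import Data.List.Relation.Unary.All.Properties using (¬Any⇒All¬)
open import Data.List.Relation.Unary.AllPairs using (AllPairs; []; _∷_)
open import Data.List.Relation.Unary.Any using (here; there)
open import Data.List.Relation.Unary.Linked using (Linked; [-]; _∷_)
open import Data.List.Relation.Unary.Unique.Propositional using (Unique)
open import Data.Nat using (ℕ; zero; suc; _≤_; _<_; z≤n; s≤s; z<s; _+_)
open import Data.Nat.Properties using (<⇒≱; m<m+n; +-suc; ≤-reflexive; module ≤-Reasoning)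
open import Data.Product using (∃; _×_; _,_; proj₁; proj₂)
open import Data.Sum using (_⊎_; inj₁; inj₂)
open import Function using (_∘_)
open import Level using (0ℓ)
open import Function.Bundles using (mk⇔; Equivalence)
open import Function.Definitions using (Injective)
open import Relation.Binary.Core using (Rel)
open import Relation.Binary.Definitions using (Transitive; _Respects_)
open import Relation.Binary.PropositionalEquality
  using (_≡_; _≢_; _≗_; refl; sym; trans; cong; subst)
open import Relation.Nullary using (¬_; yes; no; contradiction)
open import Relation.Nullary.Decidable using (_×-dec_)

open Equivalence using (to; from)

private
  variable
    A : Set
    n : ℕ

AllPairs-resp-⊇ : {R : Rel A 0ℓ} → (AllPairs R) Respects _⊇_
AllPairs-resp-⊇ []         []         = []
AllPairs-resp-⊇ (_ ∷ʳ τ)   (_ ∷ rs)   = AllPairs-resp-⊇ τ rs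
AllPairs-resp-⊇ (refl ∷ τ) (r ∷ rs)   = All-resp-⊆ τ r ∷ AllPairs-resp-⊇ τ rs

AllPairs-map-within : {P : A → Set} {R S : Rel A 0ℓ} →
                      (∀ {x y} → P x → P y → R x y → S x y) →
                      ∀ {xs} → All P xs → AllPairs R xs → AllPairs S xs
AllPairs-map-within r⇒s []         []         = []
AllPairs-map-within r⇒s (px ∷ pxs) (rs ∷ rss) =
  All.zipWith (λ (py , rxy) → r⇒s px py rxy) (pxs , rs) ∷ AllPairs-map-within r⇒s pxs rss

lookup-injective : {xs : List A} → Unique xs → Injective _≡_ _≡_ (lookup xs)
lookup-injective (_ ∷ _)  {Fin.zero}  {Fin.zero}  _  = refl
lookup-injective (x∉ ∷ _) {Fin.zero}  {Fin.suc j} eq = contradiction eq (All.lookup x∉ (∈-lookup j))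
lookup-injective (x∉ ∷ _) {Fin.suc i} {Fin.zero}  eq = contradiction (sym eq) (All.lookup x∉ (∈-lookup i))
lookup-injective (_ ∷ u)  {Fin.suc i} {Fin.suc j} eq = cong Fin.suc (lookup-injective u eq)

Unique-length≤ : {xs : List (Fin n)} → Unique xs → length xs ≤ n
Unique-length≤ u = injective⇒≤ (lookup-injective u)

module _ {_<_ : Rel A 0ℓ} (<-trans : Transitive _<_) where

  insert-sorted : ∀ x {ys} → All (λ y → x < y ⊎ y < x) ys → AllPairs _<_ ys →
                  ∃ λ zs → zs ↭ x ∷ ys × AllPairs _<_ zs
  insert-sorted x []                   [] = [ x ] , ↭-refl , [] ∷ []
  insert-sorted x {y ∷ ys} (inj₁ x<y ∷ _) sorted@(y<ys ∷ _) =
    x ∷ y ∷ ys , ↭-refl , (x<y ∷ All.map (<-trans x<y) y<ys) ∷ sorted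
  insert-sorted x {y ∷ ys} (inj₂ y<x ∷ cmp) (y<ys ∷ sorted) with insert-sorted x cmp sorted
  ... | zs , zs↭ , sorted-zs =
    y ∷ zs , ↭-trans (↭-prep y zs↭) (↭-swap y x ↭-refl) ,
    All-resp-↭ (↭-sym zs↭) (y<x ∷ y<ys) ∷ sorted-zs

  sort-strict : ∀ {xs} → AllPairs (λ x y → x < y ⊎ y < x) xs →
                ∃ λ ys → ys ↭ xs × AllPairs _<_ ys
  sort-strict []           = [] , ↭-refl , []
  sort-strict {x ∷ _} (cmp ∷ cmps) with sort-strict cmps
  ... | ys , ys↭ , sorted with insert-sorted x (All-resp-↭ (↭-sym ys↭) cmp) sorted
  ...   | zs , zs↭ , sorted-zs = zs , ↭-trans zs↭ (↭-prep x ys↭) , sorted-zs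

prefix-closing : ∀ {f : BN n} {h a as t} → Linked (Arc f) (a ∷ as) → t ∈ a ∷ as → Arc f t h →
                 ∃ λ vs → vs ⊆ as × Linked (Arc f) ((a ∷ vs) ++ [ h ])
prefix-closing {as = as} _ (here refl) t→h = [] , minimum as , t→h ∷ [-]
prefix-closing (a→b ∷ path) (there t∈) t→h with prefix-closing path t∈ t→h
... | vs , vs⊆ , closed = _ ∷ vs , refl ∷ vs⊆ , a→b ∷ closed

module _ {f : BN n} {S : Fin n → Set} (S-pred : ∀ {v} → S v → ∃ λ u → Arc f u v × S u) where

  open import Data.List.Membership.DecPropositional (_≟_ {n}) using (_∈?_)

  -- Extend a simple path backwards inside S until it closes up; a simple path has at most
  -- n vertices, so the fuel k never runs out.
  private
    backward-cycle : ∀ k {a as} → n < k + length (a ∷ as) → Unique (a ∷ as) →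
                     Linked (Arc f) (a ∷ as) → All S (a ∷ as) → ∃ λ C → IsCycle f C × All S C
    backward-cycle zero bound uniq _ _ = contradiction (Unique-length≤ uniq) (<⇒≱ bound)
    backward-cycle (suc k) {a} {as} bound uniq path inS with S-pred (All.head inS)
    ... | u , u→a , Su with u ∈? a ∷ as
    ...   | yes u∈ with prefix-closing path u∈ u→a
    ...     | vs , vs⊆ , closed =
      a ∷ vs , cycle a vs (AllPairs-resp-⊇ (refl ∷ vs⊆) uniq) closed , All-resp-⊆ (refl ∷ vs⊆) inS
    backward-cycle (suc k) {a} {as} bound uniq path inS | u , u→a , Su | no u∉ =
      backward-cycle k (subst (n <_) (sym (+-suc k _)) bound)
        (¬Any⇒All¬ _ u∉ ∷ uniq) (u→a ∷ path) (Su ∷ inS)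

  cycle-within : ∀ {v} → S v → ∃ λ C → IsCycle f C × All S C
  cycle-within Sv = backward-cycle n (m<m+n n z<s) ([] ∷ []) [-] (Sv ∷ [])

_≤ₛ_ : Rel (State n) 0ℓ
x ≤ₛ y = ∀ v → x v ≡ true → y v ≡ true

_<ₛ_ : Rel (State n) 0ℓ
x <ₛ y = x ≤ₛ y × ¬ x ≗ y

OnOff : State n → State n → Fin n → Set
OnOff x y v = x v ≡ true × y v ≡ false

≤ₛ-off : {x y : State n} → x ≤ₛ y → ∀ {v} → y v ≡ false → x v ≡ false
≤ₛ-off x≤y {v} yv = ¬-not λ xv → contradiction (trans (sym (x≤y v xv)) yv) λ ()

≤ₛ-antisym : {x y : State n} → x ≤ₛ y → y ≤ₛ x → x ≗ y
≤ₛ-antisym x≤y y≤x v = ⇔→≡ (mk⇔ (x≤y v) (y≤x v))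

<ₛ-trans : Transitive (_<ₛ_ {n})
<ₛ-trans (x≤y , x≉y) (y≤z , _) =
  (λ v → y≤z v ∘ x≤y v) ,
  λ x≗z → x≉y (≤ₛ-antisym x≤y λ v yv → subst (_≡ true) (sym (x≗z v)) (y≤z v yv))

≤ₛ-or-onOff : (x y : State n) → x ≤ₛ y ⊎ ∃ (OnOff x y)
≤ₛ-or-onOff x y with any? (λ v → (x v Bool.≟ true) ×-dec (y v Bool.≟ false))
... | yes gap = inj₂ gap
... | no ¬gap = inj₁ λ v xv → ¬-not λ yv → ¬gap (v , xv , yv)

<ₛ⇒onOff : {x y : State n} → x <ₛ y → ∃ (OnOff y x)
<ₛ⇒onOff {x = x} {y} (x≤y , x≉y) with ≤ₛ-or-onOff y x
... | inj₁ y≤x = contradiction (≤ₛ-antisym x≤y y≤x) x≉y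
... | inj₂ gap = gap

on-off-disjoint : {x : State n} {C D : List (Fin n)} →
                  All (λ w → x w ≡ true) C → All (λ w → x w ≡ false) D → Disjoint C D
on-off-disjoint onC offD w w∈C w∈D =
  contradiction (trans (sym (All.lookup onC w∈C)) (All.lookup offD w∈D)) λ ()

∉-∷ : {w u : A} {L : List A} → w ≢ u → w ∉ L → w ∉ u ∷ L
∉-∷ w≢u _   (here w≡u)  = w≢u w≡u
∉-∷ _   w∉L (there w∈L) = w∉L w∈L

Extensional : BN n → Set
Extensional f = ∀ {x y} → x ≗ y → f x ≗ f y

-- Walk from z to z' flipping one disagreeing coordinate at a time; the first flip that
-- changes f_v exhibits an arc into v.
arc-witness : {f : BN n} → Extensional f → ∀ {z z'} v → f z v ≢ f z' v →
              ∃ λ u → Arc f u v × z u ≢ z' u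
arc-witness {n} {f} ext {z} {z'} v =
  walk (allFin n) λ w w∉ → contradiction (∈-allFin w) w∉
  where
  walk : ∀ L {z} → (∀ w → w ∉ L → z w ≡ z' w) → f z v ≢ f z' v → ∃ λ u → Arc f u v × z u ≢ z' u
  walk []      agree fv≢ = contradiction (ext (λ w → agree w λ ()) v) fv≢
  walk (u ∷ L) {z} agree fv≢ with z u Bool.≟ z' u
  ... | yes zu≡ = walk L agree′ fv≢
    where
    agree′ : ∀ w → w ∉ L → z w ≡ z' w
    agree′ w w∉L with w ≟ u
    ... | yes refl = zu≡
    ... | no w≢u   = agree w (∉-∷ w≢u w∉L)
  ... | no zu≢ with f z v Bool.≟ f (flipAt z u) v
  ...   | no changed = u , (z , changed) , zu≢
  ...   | yes same with walk L agree′ (fv≢ ∘ trans same)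
    where
    agree′ : ∀ w → w ∉ L → flipAt z u w ≡ z' w
    agree′ w w∉L with w ≟ u
    ... | yes refl = sym (¬-not (zu≢ ∘ sym))
    ... | no w≢u   = agree w (∉-∷ w≢u w∉L)
  ...     | w , arc , flip≢ with w ≟ u
  ...       | yes refl = w , arc , zu≢
  ...       | no _     = w , arc , flip≢

module _ {f : BN n} (andOr : AndOrNetwork f) where

  private
    true-transfer : ∀ {x y v} → x ≗ y → f x v ≡ true → f y v ≡ true
    true-transfer {x} {y} {v} x≗y fx with andOr v
    ... | isAnd and = from (and y) λ u arc → trans (sym (x≗y u)) (to (and x) fx u arc)
    ... | isOr or with to (or x) fx
    ...   | u , arc , xu = from (or y) (u , arc , trans (sym (x≗y u)) xu)

  andOr-extensional : Extensional f
  andOr-extensional x≗y v = ⇔→≡ (mk⇔ (true-transfer x≗y) (true-transfer (sym ∘ x≗y)))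

  module _ {x y : State n} (fix-x : FixedPoint f x) (fix-y : FixedPoint f y) where

    onOff-pred : ∀ {v} → OnOff x y v → ∃ λ u → Arc f u v × OnOff x y u
    onOff-pred {v} (xv , yv) with arc-witness andOr-extensional v fv≢ | andOr v
      where
      fv≢ : f x v ≢ f y v
      fv≢ fx≡fy = contradiction (trans (sym (trans (fix-x v) xv)) (trans fx≡fy (trans (fix-y v) yv))) λ ()
    ... | u , arc , xu≢yu | isAnd and =
      let xu = to (and x) (trans (fix-x v) xv) u arc
      in u , arc , xu , ¬-not (xu≢yu ∘ trans xu ∘ sym)
    ... | u , arc , xu≢yu | isOr or =
      let yu = ¬-not λ yu → contradiction (trans (sym (from (or y) (u , arc , yu))) (trans (fix-y v) yv)) λ ()
      in u , arc , ¬-not (xu≢yu ∘ (λ xu → trans xu (sym yu))) , yu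

    onOff-no-arc-back : ∀ {u w} → OnOff x y u → OnOff y x w → ¬ Arc f u w
    onOff-no-arc-back {u} {w} (xu , yu) (yw , xw) arc with andOr w
    ... | isAnd and = contradiction (trans (sym (to (and y) (trans (fix-y w) yw) u arc)) yu) λ ()
    ... | isOr or   = contradiction (trans (sym (from (or x) (u , arc , xu))) (trans (fix-x w) xw)) λ ()

    onOff-cycle : ∀ {v} → OnOff x y v → ∃ λ C → IsCycle f C × All (OnOff x y) C
    onOff-cycle = cycle-within onOff-pred

  fixedPoints-trichotomous : NoTwoIndependentCycles f → ∀ {x y} → FixedPoint f x → FixedPoint f y →
                             ¬ x ≗ y → x <ₛ y ⊎ y <ₛ x
  fixedPoints-trichotomous noIndep {x} {y} fix-x fix-y x≉y
    with ≤ₛ-or-onOff x y | ≤ₛ-or-onOff y x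
  ... | inj₁ x≤y | _        = inj₁ (x≤y , x≉y)
  ... | inj₂ _   | inj₁ y≤x = inj₂ (y≤x , λ y≗x → x≉y (sym ∘ y≗x))
  ... | inj₂ (_ , gap-xy) | inj₂ (_ , gap-yx)
    with onOff-cycle fix-x fix-y gap-xy | onOff-cycle fix-y fix-x gap-yx
  ...   | C , cycle-C , C-xy | D , cycle-D , D-yx =
    contradiction
      ( on-off-disjoint (All.map proj₁ C-xy) (All.map proj₂ D-yx)
      , (λ u w u∈C w∈D → onOff-no-arc-back fix-x fix-y (All.lookup C-xy u∈C) (All.lookup D-yx w∈D))
      , (λ u w u∈D w∈C → onOff-no-arc-back fix-y fix-x (All.lookup D-yx u∈D) (All.lookup C-xy w∈C)))
      (noIndep C D cycle-C cycle-D)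

  cycles-off-head : ∀ {y ys} → All (FixedPoint f) (y ∷ ys) → AllPairs _<ₛ_ (y ∷ ys) →
                    ∃ λ Cs → DisjointCycles f Cs × length Cs ≡ length ys ×
                             All (All (λ w → y w ≡ false)) Cs
  cycles-off-head {ys = []} _ _ = [] , ([] , []) , refl , []
  cycles-off-head {ys = _ ∷ _} (fix-y ∷ fixes) ((y<z ∷ _) ∷ sorted)
    with cycles-off-head fixes sorted | <ₛ⇒onOff y<z
  ... | Cs , (cycles , disjoint) , |Cs| , Cs-off-z | _ , gap
    with onOff-cycle (All.head fixes) fix-y gap
  ...   | C , cycle-C , C-zy =
    C ∷ Cs ,
    (cycle-C ∷ cycles ,
     All.map (on-off-disjoint (All.map proj₁ C-zy)) Cs-off-z ∷ disjoint) ,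
    cong suc |Cs| ,
    All.map proj₂ C-zy ∷ All.map (All.map (≤ₛ-off (proj₁ y<z))) Cs-off-z

  chain-cycles : ∀ {ys} → All (FixedPoint f) ys → AllPairs _<ₛ_ ys →
                 ∃ λ Cs → DisjointCycles f Cs × length ys ≤ suc (length Cs)
  chain-cycles []              _      = [] , ([] , []) , z≤n
  chain-cycles fixes@(_ ∷ _) sorted with cycles-off-head fixes sorted
  ... | Cs , disjointCycles , |Cs| , _ = Cs , disjointCycles , s≤s (≤-reflexive (sym |Cs|))

lemma7 : ∀ (n : ℕ) (f : BN n) (ν : ℕ) → AndOrNetwork f → NoTwoIndependentCycles f →
    IsMaxDisjointCycles f ν →
    ∀ (xs : List (State n)) → DistinctFixedPoints f xs → length xs ≤ suc ν
lemma7 n f ν andOr noIndep (_ , maximal) xs (fixes , distinct)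
  with sort-strict <ₛ-trans (AllPairs-map-within (fixedPoints-trichotomous andOr noIndep) fixes distinct)
... | ys , ys↭xs , sorted with chain-cycles andOr (All-resp-↭ (↭-sym ys↭xs) fixes) sorted
...   | Cs , disjointCycles , |ys|≤ = begin
  length xs        ≡⟨ ↭-length (↭-sym ys↭xs) ⟩
  length ys        ≤⟨ |ys|≤ ⟩
  suc (length Cs)  ≤⟨ s≤s (maximal Cs disjointCycles) ⟩
  suc ν            ∎
  where open ≤-Reasoning
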